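{- Let $L=(X,\leq)$ be a finite upper locally distributive lattice. For each meet-irreducible $m$ of $L$, $$\mathfrak{U}_m=\{j^{ - }: j\in J \text{ and } j\downarrow m\}.$$
   Context: $x\prec y$ means $y$ covers $x$. $M$ is the set of meet-irreducibles (elements with exactly one upper cover), $M_x=\{m\in M:x\le m\}$; $J$ is the set of join-irreducibles (elements with exactly one lower cover), and for $j\in J$, $j^{ - }$ denotes its unique lower cover. For $x\neq\mathbf{1}$, $x^{+}$ is the join of all upper covers of $x$; $L$ is upper locally distributive if $[x,x^{+}]$ is a Boolean lattice for every $x\neq\mathbf{1}$. In such a lattice, for every cover $x\prec y$ the set $M_x\setminus M_y$ has exactly one element, denoted $\mathfrak{m}(x,y)$. For $m\in M$, $\mathfrak{U}_m$ is the set of minimal elements of $\{x\in X:\exists y\in X,\ x\prec y,\ \mathfrak{m}(x,y)=m\}$. For $j\in J$, $m\in M$, $j\downarrow m$ means $j$ is a minimal element of $X\setminus\{x\in X:x\le m\}$. -}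

module Defs where

open import Level using (0ℓ)
open import Data.Nat using (ℕ)
open import Data.Fin using (Fin)
open import Data.Product using (Σ; ∃; ∃-syntax; _×_)
open import Data.Sum using (_⊎_)
open import Relation.Nullary using (¬_)
open import Relation.Binary using (Rel)
open import Relation.Binary.PropositionalEquality using (_≡_; _≢_)
open import Algebra.Core using (Op₂)
open import Relation.Binary.Lattice.Structures using (IsLattice)

-- A finite lattice L = (X, ≤): WLOG (up to isomorphism) X = Fin n,
-- with propositional equality as the equality of the lattice.
record FinLattice (n : ℕ) : Set₁ where
  field
    _≤_ : Rel (Fin n) 0ℓ
    _∨_ : Op₂ (Fin n)
    _∧_ : Op₂ (Fin n)
    isLattice : IsLattice _≡_ _≤_ _∨_ _∧_

module Notions {n : ℕ} (L : FinLattice n) where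
  open FinLattice L

  X : Set
  X = Fin n

  _<_ : X → X → Set
  x < y = x ≤ y × x ≢ y

  _⋖_ : X → X → Set
  x ⋖ y = x < y × (∀ z → x ≤ z → z ≤ y → z ≡ x ⊎ z ≡ y)

  IsMeetIrr : X → Set
  IsMeetIrr x = ∃[ u ] (x ⋖ u × (∀ v → x ⋖ v → v ≡ u))

  IsJoinIrr : X → Set
  IsJoinIrr x = ∃[ d ] (d ⋖ x × (∀ e → e ⋖ x → e ≡ d))

  IsTop : X → Set
  IsTop x = ∀ y → y ≤ x

  IsPlus : X → X → Set
  IsPlus x s = (∀ u → x ⋖ u → u ≤ s)
             × (∀ t → (∀ u → x ⋖ u → u ≤ t) → s ≤ t)

  -- The interval [a, b] (with the induced meet and join) is a Boolean lattice:
  -- distributive, bounded by a and b, and complemented.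
  InInterval : X → X → X → Set
  InInterval a b z = a ≤ z × z ≤ b

  IsBooleanInterval : X → X → Set
  IsBooleanInterval a b =
      (∀ p q r → InInterval a b p → InInterval a b q → InInterval a b r →
         p ∧ (q ∨ r) ≡ (p ∧ q) ∨ (p ∧ r))
    × (∀ p → InInterval a b p →
         ∃[ q ] (InInterval a b q × (p ∧ q ≡ a) × (p ∨ q ≡ b)))

  UpperLocallyDistributive : Set
  UpperLocallyDistributive =
    ∀ x s → ¬ IsTop x → IsPlus x s → IsBooleanInterval x s

  -- 𝔪(x,y) = m, i.e. m ∈ M_x \ M_y (this set is a singleton for covers
  -- in an upper locally distributive lattice)
  IsFrakM : X → X → X → Set
  IsFrakM x y m = IsMeetIrr m × x ≤ m × ¬ (y ≤ m)

  InS : X → X → Set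
  InS m x = ∃[ y ] (x ⋖ y × IsFrakM x y m)

  InFrakU : X → X → Set
  InFrakU m x = InS m x × (∀ z → InS m z → z ≤ x → z ≡ x)

  _↓_ : X → X → Set
  j ↓ m = ¬ (j ≤ m) × (∀ z → ¬ (z ≤ m) → z ≤ j → z ≡ j)

--  * Finite lattices: the order is decidable and every partial order on
--    Fin n is well-founded, so decidable predicates have minimal and maximal
--    witnesses, strict inequalities refine to covers, and x⁺ exists.
--  * No distributivity needed: a cover e ⋖ j leaving ↓m dominates ↓j ∩ ↓m.
--    Hence a minimal j outside ↓m is join-irreducible with j⁻ ≤ m, and every
--    x ∈ 𝔘_m is such a j⁻ (forward direction).
--  * Distributivity of [z, z⁺] lets covers be pushed upwards (z ⋖ y, z ≤ x,
--    y ≰ x give x ⋖ x ∨ y) and shows that, for m meet-irreducible, each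
--    x ≤ m has at most one upper cover outside ↓m. Together these make j⁻
--    minimal among the elements leaving ↓m by a cover (backward direction).
module Submission where

open import Defs
open import Data.Nat using (ℕ)
open import Data.Product using (Σ; ∃; ∃-syntax; _×_)
open import Function.Bundles using (_⇔_)

open import Level using (0ℓ)
open import Data.Empty using (⊥-elim)
open import Data.Fin using (Fin)
open import Data.Fin.Induction using (po-wellFounded; po-noetherian)
open import Data.Fin.Properties using (_≟_; any?; all?)
open import Data.List using (_∷_; []; foldr; filter; allFin)
open import Data.List.Membership.Propositional using (_∈_)
open import Data.List.Membership.Propositional.Properties using (∈-allFin; ∈-filter⁺; ∈-filter⁻)
open import Data.List.Relation.Unary.Any using (here; there)
open import Data.Product using (_,_; proj₁; proj₂)
open import Data.Sum using (_⊎_; inj₁; inj₂)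
open import Function.Base using (flip; _∘_)
open import Function.Bundles using (mk⇔)
open import Induction.WellFounded using (Acc; acc)
open import Relation.Binary using (Rel; Decidable; IsPartialOrder)
import Relation.Binary.Construct.Flip.EqAndOrd as Flip
import Relation.Binary.Construct.NonStrictToStrict as ToStrict
open import Relation.Binary.Lattice using (Lattice; IsLattice)
open import Relation.Binary.PropositionalEquality using (_≡_; _≢_; refl; sym; trans; subst; cong; cong₂; ≢-sym; module ≡-Reasoning)
open import Relation.Nullary using (¬_; Dec; yes; no)
open import Relation.Nullary.Decidable using (map′; _×-dec_; _⊎-dec_; ¬?; _→-dec_; decidable-stable)

-- In a partial order on Fin n with decidable order, a decidable predicate
-- holding at a has a minimal witness below a: descend while possible, which
-- terminates because strict partial orders on Fin n are well-founded.
module Extremal {n : ℕ} {_⊑_ : Rel (Fin n) 0ℓ}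
                (isPO : IsPartialOrder _≡_ _⊑_) (_⊑?_ : Decidable _⊑_) where
  open IsPartialOrder isPO using () renaming (refl to ⊑-refl; trans to ⊑-trans)

  minimalBelow : (P : Fin n → Set) → (∀ a → Dec (P a)) → ∀ {a} → P a →
                 ∃[ c ] (P c × c ⊑ a × (∀ w → P w → w ⊑ c → w ≡ c))
  minimalBelow P P? {a} Pa = descend a Pa (po-wellFounded isPO a)
    where
    descend : ∀ a → P a → Acc (ToStrict._<_ _≡_ _⊑_) a →
              ∃[ c ] (P c × c ⊑ a × (∀ w → P w → w ⊑ c → w ≡ c))
    descend a Pa (acc below) with any? (λ w → P? w ×-dec (w ⊑? a) ×-dec ¬? (w ≟ a))
    ... | yes (w , Pw , w⊑a , w≢a) with descend w Pw (below (w⊑a , w≢a))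
    ...   | c , Pc , c⊑w , minimal = c , Pc , ⊑-trans c⊑w w⊑a , minimal
    descend a Pa (acc below) | no noneBelow =
      a , Pa , ⊑-refl ,
      λ w Pw w⊑a → decidable-stable (w ≟ a) (λ w≢a → noneBelow (w , Pw , w⊑a , w≢a))

module FiniteLattice {n : ℕ} (L : FinLattice n) where
  open FinLattice L
  open Notions L public
  open IsLattice isLattice public
    using (antisym; x≤x∨y; y≤x∨y; ∨-least; x∧y≤x; x∧y≤y; ∧-greatest)
    renaming (refl to ≤-refl; trans to ≤-trans)
  open IsLattice isLattice using (isPartialOrder)

  private
    bundle : Lattice 0ℓ 0ℓ 0ℓ
    bundle = record { isLattice = isLattice }

  open import Relation.Binary.Lattice.Properties.JoinSemilattice (Lattice.joinSemilattice bundle)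
    using (∨-comm; ∨-assoc) renaming (x≤y⇒x∨y≈y to x≤y⇒x∨y≡y)
  open import Relation.Binary.Lattice.Properties.MeetSemilattice (Lattice.meetSemilattice bundle)
    using (∧-comm) renaming (y≤x⇒x∧y≈y to y≤x⇒x∧y≡y)

  x≤y⇒x∧y≡x : ∀ {x y} → x ≤ y → (x ∧ y) ≡ x
  x≤y⇒x∧y≡x {x} {y} x≤y = trans (∧-comm x y) (y≤x⇒x∧y≡y x≤y)

  y≤x⇒x∨y≡x : ∀ {x y} → y ≤ x → (x ∨ y) ≡ x
  y≤x⇒x∨y≡x {x} {y} y≤x = trans (∨-comm x y) (x≤y⇒x∨y≡y y≤x)

  ∨-absorbs-below : ∀ {x t} y → t ≤ x → (x ∨ (t ∨ y)) ≡ (x ∨ y)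
  ∨-absorbs-below {x} {t} y t≤x = begin
    x ∨ (t ∨ y)  ≡⟨ sym (∨-assoc x t y) ⟩
    (x ∨ t) ∨ y  ≡⟨ cong (_∨ y) (y≤x⇒x∨y≡x t≤x) ⟩
    x ∨ y        ∎
    where open ≡-Reasoning

  ≰-∨ : ∀ {m u} t → ¬ (u ≤ m) → ¬ ((t ∨ u) ≤ m)
  ≰-∨ t u≰m t∨u≤m = u≰m (≤-trans (y≤x∨y t _) t∨u≤m)

  ≰-≢ : ∀ {m u t} → t ≤ m → ¬ (u ≤ m) → u ≢ t
  ≰-≢ t≤m u≰m refl = u≰m t≤m

  ⋖⇒< : ∀ {x y} → x ⋖ y → x < y
  ⋖⇒< = proj₁

  ⋖⇒≤ : ∀ {x y} → x ⋖ y → x ≤ y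
  ⋖⇒≤ = proj₁ ∘ proj₁

  ⋖⇒≢ : ∀ {x y} → x ⋖ y → x ≢ y
  ⋖⇒≢ = proj₂ ∘ proj₁

  ⋖-tight : ∀ {x y} → x ⋖ y → ∀ v → x ≤ v → v ≤ y → v ≡ x ⊎ v ≡ y
  ⋖-tight = proj₂

  meetOfCovers : ∀ {z a b} → z ⋖ a → z ⋖ b → a ≢ b → (a ∧ b) ≡ z
  meetOfCovers {z} {a} {b} z⋖a z⋖b a≢b
    with ⋖-tight z⋖a (a ∧ b) (∧-greatest (⋖⇒≤ z⋖a) (⋖⇒≤ z⋖b)) (x∧y≤x a b)
  ... | inj₁ a∧b≡z = a∧b≡z
  ... | inj₂ a∧b≡a with ⋖-tight z⋖b a (⋖⇒≤ z⋖a) (subst (_≤ b) a∧b≡a (x∧y≤y a b))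
  ...   | inj₁ a≡z = ⊥-elim (⋖⇒≢ z⋖a (sym a≡z))
  ...   | inj₂ a≡b = ⊥-elim (a≢b a≡b)

  _≤?_ : ∀ a b → Dec (a ≤ b)
  a ≤? b = map′ (λ a∨b≡b → subst (a ≤_) a∨b≡b (x≤x∨y a b)) x≤y⇒x∨y≡y ((a ∨ b) ≟ b)

  _⋖?_ : ∀ a b → Dec (a ⋖ b)
  a ⋖? b = ((a ≤? b) ×-dec ¬? (a ≟ b))
           ×-dec all? (λ v → (a ≤? v) →-dec ((v ≤? b) →-dec ((v ≟ a) ⊎-dec (v ≟ b))))

  open Extremal isPartialOrder _≤?_ public using (minimalBelow)
  open Extremal (Flip.isPartialOrder isPartialOrder) (flip _≤?_) public
    renaming (minimalBelow to maximalAbove)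

  upward : ∀ x → Acc (flip _<_) x
  upward = po-noetherian isPartialOrder

  coverAbove : ∀ {x b} → x < b → ∃[ t ] (x ⋖ t × t ≤ b)
  coverAbove {x} x<b with minimalBelow (x <_) (λ w → (x ≤? w) ×-dec ¬? (x ≟ w)) x<b
  ... | t , x<t , t≤b , minimal = t , (x<t , tight) , t≤b
    where
    tight : ∀ v → x ≤ v → v ≤ t → v ≡ x ⊎ v ≡ t
    tight v x≤v v≤t with x ≟ v
    ... | yes x≡v = inj₁ (sym x≡v)
    ... | no x≢v = inj₂ (minimal v (x≤v , x≢v) v≤t)

  coverBelow : ∀ {a b} → a < b → ∃[ c ] (a ≤ c × c ⋖ b)
  coverBelow {b = b} a<b with maximalAbove (_< b) (λ w → (w ≤? b) ×-dec ¬? (w ≟ b)) a<b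
  ... | c , c<b , a≤c , maximal = c , a≤c , (c<b , tight)
    where
    tight : ∀ v → c ≤ v → v ≤ b → v ≡ c ⊎ v ≡ b
    tight v c≤v v≤b with v ≟ b
    ... | yes v≡b = inj₂ v≡b
    ... | no v≢b = inj₁ (maximal v (v≤b , v≢b) c≤v)

  ≤-foldr-∨ : ∀ z {w ws} → w ∈ ws → w ≤ foldr _∨_ z ws
  ≤-foldr-∨ z (here refl) = x≤x∨y _ _
  ≤-foldr-∨ z (there w∈ws) = ≤-trans (≤-foldr-∨ z w∈ws) (y≤x∨y _ _)

  foldr-∨-least : ∀ {z t} ws → z ≤ t → (∀ {w} → w ∈ ws → w ≤ t) → foldr _∨_ z ws ≤ t
  foldr-∨-least [] z≤t bound = z≤t
  foldr-∨-least (w ∷ ws) z≤t bound = ∨-least (bound (here refl)) (foldr-∨-least ws z≤t (bound ∘ there))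

  _⁺ : X → X
  x ⁺ = foldr _∨_ x (filter (x ⋖?_) (allFin n))

  cover≤⁺ : ∀ {x u} → x ⋖ u → u ≤ (x ⁺)
  cover≤⁺ {x} {u} x⋖u = ≤-foldr-∨ x (∈-filter⁺ (x ⋖?_) (∈-allFin u) x⋖u)

  coverInInterval : ∀ {x u} → x ⋖ u → InInterval x (x ⁺) u
  coverInInterval x⋖u = ⋖⇒≤ x⋖u , cover≤⁺ x⋖u

  ⁺-isPlus : ∀ {x y} → x ⋖ y → IsPlus x (x ⁺)
  ⁺-isPlus {x} x⋖y =
    (λ u → cover≤⁺) ,
    (λ t bound → foldr-∨-least (filter (x ⋖?_) (allFin n)) (≤-trans (⋖⇒≤ x⋖y) (bound _ x⋖y))
                   (λ w∈ → bound _ (proj₂ (∈-filter⁻ (x ⋖?_) {xs = allFin n} w∈))))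

  ⋖⇒¬top : ∀ {x y} → x ⋖ y → ¬ IsTop x
  ⋖⇒¬top x⋖y top = ⋖⇒≢ x⋖y (antisym (⋖⇒≤ x⋖y) (top _))

  -- A cover e ⋖ j leaving ↓m (e ≤ m, j ≰ m) dominates ↓j ∩ ↓m: e ∨ c lies in
  -- [e, j] and below m, so it cannot be j.
  belowExit : ∀ {m e j c} → e ⋖ j → e ≤ m → ¬ (j ≤ m) → c ≤ j → c ≤ m → c ≤ e
  belowExit {m} {e} {j} {c} e⋖j e≤m j≰m c≤j c≤m
    with ⋖-tight e⋖j (e ∨ c) (x≤x∨y e c) (∨-least (⋖⇒≤ e⋖j) c≤j)
  ... | inj₁ e∨c≡e = subst (c ≤_) e∨c≡e (y≤x∨y e c)
  ... | inj₂ e∨c≡j = ⊥-elim (j≰m (subst (_≤ m) e∨c≡j (∨-least e≤m c≤m)))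

  lowerCover≤ : ∀ {m j e} → j ↓ m → e ⋖ j → e ≤ m
  lowerCover≤ {m} {j} {e} (_ , minimal) e⋖j =
    decidable-stable (e ≤? m) (λ e≰m → ⋖⇒≢ e⋖j (minimal e e≰m (⋖⇒≤ e⋖j)))

  -- A minimal element of X ∖ ↓m is join-irreducible: it has a lower cover
  -- (above j ∧ m < j), and any two lower covers dominate each other by belowExit.
  ↓⇒joinIrr : ∀ {m j} → j ↓ m → IsJoinIrr j
  ↓⇒joinIrr {m} {j} j↓m@(j≰m , _) with coverBelow (x∧y≤x j m , j∧m≢j)
    where
    j∧m≢j : (j ∧ m) ≢ j
    j∧m≢j j∧m≡j = j≰m (subst (_≤ m) j∧m≡j (x∧y≤y j m))
  ... | c , _ , c⋖j = c , c⋖j , onlyLowerCover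
    where
    onlyLowerCover : ∀ e → e ⋖ j → e ≡ c
    onlyLowerCover e e⋖j =
      antisym (belowExit c⋖j (lowerCover≤ j↓m c⋖j) j≰m (⋖⇒≤ e⋖j) (lowerCover≤ j↓m e⋖j))
              (belowExit e⋖j (lowerCover≤ j↓m e⋖j) j≰m (⋖⇒≤ c⋖j) (lowerCover≤ j↓m c⋖j))

  -- Forward inclusion: x ∈ 𝔘_m, leaving ↓m by x ⋖ y, is the lower cover of a
  -- minimal element j ≤ y of X ∖ ↓m: j⁻ also leaves ↓m by a cover, and
  -- j⁻ ≤ x by belowExit, so j⁻ = x by minimality of x.
  frakU⇒lowerCover : ∀ {m x} → InFrakU m x → ∃[ j ] (IsJoinIrr j × j ↓ m × x ⋖ j)
  frakU⇒lowerCover {m} {x} ((y , x⋖y , m-irr , x≤m , y≰m) , x-minimal)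
    with minimalBelow (λ w → ¬ (w ≤ m)) (λ w → ¬? (w ≤? m)) y≰m
  ... | j , j≰m , j≤y , j-minimal with ↓⇒joinIrr (j≰m , j-minimal)
  ...   | c , c⋖j , onlyLowerCover = j , (c , c⋖j , onlyLowerCover) , (j≰m , j-minimal) , x⋖j
    where
    c≤m : c ≤ m
    c≤m = lowerCover≤ (j≰m , j-minimal) c⋖j
    c≡x : c ≡ x
    c≡x = x-minimal c (j , c⋖j , m-irr , c≤m , j≰m)
                    (belowExit x⋖y x≤m y≰m (≤-trans (⋖⇒≤ c⋖j) j≤y) c≤m)
    x⋖j : x ⋖ j
    x⋖j = subst (_⋖ j) c≡x c⋖j

  module LocallyDistributive (uld : UpperLocallyDistributive) where

    localDistrib : ∀ {z y p q r} → z ⋖ y →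
                   InInterval z (z ⁺) p → InInterval z (z ⁺) q → InInterval z (z ⁺) r →
                   (p ∧ (q ∨ r)) ≡ ((p ∧ q) ∨ (p ∧ r))
    localDistrib {z} {y} {p} {q} {r} z⋖y =
      proj₁ (uld z (z ⁺) (⋖⇒¬top z⋖y) (⁺-isPlus z⋖y)) p q r

    -- Two different covers y, t of z: t ⋖ t ∨ y. Each v ∈ [t, t ∨ y] equals
    -- t ∨ (v ∧ y) by distributivity, and v ∧ y ∈ [z, y] is z or y.
    coverShift : ∀ {z y t} → z ⋖ y → z ⋖ t → y ≢ t → t ⋖ (t ∨ y)
    coverShift {z} {y} {t} z⋖y z⋖t y≢t = (x≤x∨y t y , t≢t∨y) , between
      where
      t∨y≤z⁺ : (t ∨ y) ≤ (z ⁺)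
      t∨y≤z⁺ = ∨-least (cover≤⁺ z⋖t) (cover≤⁺ z⋖y)

      t≢t∨y : t ≢ (t ∨ y)
      t≢t∨y t≡t∨y with ⋖-tight z⋖t y (⋖⇒≤ z⋖y) (subst (y ≤_) (sym t≡t∨y) (y≤x∨y t y))
      ... | inj₁ y≡z = ⋖⇒≢ z⋖y (sym y≡z)
      ... | inj₂ y≡t = y≢t y≡t

      split : ∀ {v} → t ≤ v → v ≤ (t ∨ y) → v ≡ (t ∨ (v ∧ y))
      split {v} t≤v v≤t∨y = begin
        v                  ≡⟨ sym (x≤y⇒x∧y≡x v≤t∨y) ⟩
        v ∧ (t ∨ y)        ≡⟨ localDistrib z⋖y v∈ (coverInInterval z⋖t) (coverInInterval z⋖y) ⟩
        (v ∧ t) ∨ (v ∧ y)  ≡⟨ cong (_∨ (v ∧ y)) (y≤x⇒x∧y≡y t≤v) ⟩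
        t ∨ (v ∧ y)        ∎
        where
        open ≡-Reasoning
        v∈ : InInterval z (z ⁺) v
        v∈ = ≤-trans (⋖⇒≤ z⋖t) t≤v , ≤-trans v≤t∨y t∨y≤z⁺

      between : ∀ v → t ≤ v → v ≤ (t ∨ y) → v ≡ t ⊎ v ≡ (t ∨ y)
      between v t≤v v≤t∨y
        with ⋖-tight z⋖y (v ∧ y) (∧-greatest (≤-trans (⋖⇒≤ z⋖t) t≤v) (⋖⇒≤ z⋖y)) (x∧y≤y v y)
      ... | inj₁ v∧y≡z = inj₁ (trans (split t≤v v≤t∨y)
                                (trans (cong (t ∨_) v∧y≡z) (y≤x⇒x∨y≡x (⋖⇒≤ z⋖t))))
      ... | inj₂ v∧y≡y = inj₂ (trans (split t≤v v≤t∨y) (cong (t ∨_) v∧y≡y))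

    -- Joining a cover t of z with two further covers u₁ ≠ u₂ gives different
    -- elements: otherwise u₂ = u₂ ∧ (t ∨ u₁) = (u₂ ∧ t) ∨ (u₂ ∧ u₁) = z.
    joinsOfCoversDiffer : ∀ {z t u₁ u₂} → z ⋖ t → z ⋖ u₁ → z ⋖ u₂ → t ≢ u₂ → u₁ ≢ u₂ →
                          (t ∨ u₁) ≢ (t ∨ u₂)
    joinsOfCoversDiffer {z} {t} {u₁} {u₂} z⋖t z⋖u₁ z⋖u₂ t≢u₂ u₁≢u₂ t∨u₁≡t∨u₂ =
      ⋖⇒≢ z⋖u₂ (sym u₂≡z)
      where
      open ≡-Reasoning
      u₂≤t∨u₁ : u₂ ≤ (t ∨ u₁)
      u₂≤t∨u₁ = subst (u₂ ≤_) (sym t∨u₁≡t∨u₂) (y≤x∨y t u₂)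
      u₂≡z : u₂ ≡ z
      u₂≡z = begin
        u₂                      ≡⟨ sym (x≤y⇒x∧y≡x u₂≤t∨u₁) ⟩
        u₂ ∧ (t ∨ u₁)           ≡⟨ localDistrib z⋖u₂ (coverInInterval z⋖u₂)
                                     (coverInInterval z⋖t) (coverInInterval z⋖u₁) ⟩
        (u₂ ∧ t) ∨ (u₂ ∧ u₁)    ≡⟨ cong₂ _∨_ (meetOfCovers z⋖u₂ z⋖t (≢-sym t≢u₂))
                                             (meetOfCovers z⋖u₂ z⋖u₁ (≢-sym u₁≢u₂)) ⟩
        z ∨ z                   ≡⟨ x≤y⇒x∨y≡y ≤-refl ⟩
        z                       ∎

    -- Covers move upwards: z ⋖ y, z ≤ x and y ≰ x give x ⋖ x ∨ y. Climb from
    -- z to x one cover t at a time, replacing y by t ∨ y (coverShift).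
    liftCover : ∀ {z y x} → z ⋖ y → z ≤ x → ¬ (y ≤ x) → x ⋖ (x ∨ y)
    liftCover {z} = climb (upward z)
      where
      climb : ∀ {z y x} → Acc (flip _<_) z → z ⋖ y → z ≤ x → ¬ (y ≤ x) → x ⋖ (x ∨ y)
      climb {z} {y} {x} (acc above) z⋖y z≤x y≰x with z ≟ x
      ... | yes refl = subst (x ⋖_) (sym (x≤y⇒x∨y≡y (⋖⇒≤ z⋖y))) z⋖y
      ... | no z≢x with coverAbove (z≤x , z≢x)
      ...   | t , z⋖t , t≤x =
        subst (x ⋖_) (∨-absorbs-below y t≤x)
          (climb (above (⋖⇒< z⋖t)) (coverShift z⋖y z⋖t (≰-≢ t≤x y≰x)) t≤x (≰-∨ t y≰x))

    -- Climb from x to m along a cover t ≤ m; at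
    -- m this is meet-irreducibility, and joinsOfCoversDiffer transports
    -- distinctness of exits from x to t.
    exitCoverUnique : ∀ {m x u₁ u₂} → IsMeetIrr m → x ≤ m → x ⋖ u₁ → x ⋖ u₂ →
                      ¬ (u₁ ≤ m) → ¬ (u₂ ≤ m) → u₁ ≡ u₂
    exitCoverUnique {m} {x} (_ , _ , onlyUpperCover) = climb (upward x)
      where
      climb : ∀ {x u₁ u₂} → Acc (flip _<_) x → x ≤ m → x ⋖ u₁ → x ⋖ u₂ →
              ¬ (u₁ ≤ m) → ¬ (u₂ ≤ m) → u₁ ≡ u₂
      climb {x} {u₁} {u₂} (acc above) x≤m x⋖u₁ x⋖u₂ u₁≰m u₂≰m with u₁ ≟ u₂ | x ≟ m
      ... | yes u₁≡u₂ | _ = u₁≡u₂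
      ... | no u₁≢u₂ | yes refl = trans (onlyUpperCover u₁ x⋖u₁) (sym (onlyUpperCover u₂ x⋖u₂))
      ... | no u₁≢u₂ | no x≢m with coverAbove (x≤m , x≢m)
      ...   | t , x⋖t , t≤m =
        ⊥-elim (joinsOfCoversDiffer x⋖t x⋖u₁ x⋖u₂ (≢-sym (≰-≢ t≤m u₂≰m)) u₁≢u₂
                  (climb (above (⋖⇒< x⋖t)) t≤m
                     (coverShift x⋖u₁ x⋖t (≰-≢ t≤m u₁≰m)) (coverShift x⋖u₂ x⋖t (≰-≢ t≤m u₂≰m))
                     (≰-∨ t u₁≰m) (≰-∨ t u₂≰m)))

    -- Backward inclusion: j⁻ = x leaves ↓m via x ⋖ j. If z ⋖ y also leaves ↓m
    -- with z ≤ x, then x ⋖ x ∨ y (liftCover) is another exit of x, so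
    -- j = x ∨ y ≥ y, hence y = j by minimality and z = j⁻ = x.
    lowerCover⇒frakU : ∀ {m x} → IsMeetIrr m → ∃[ j ] (IsJoinIrr j × j ↓ m × x ⋖ j) →
                       InFrakU m x
    lowerCover⇒frakU {m} {x} m-irr (j , (_ , _ , onlyLowerCover) , j↓m@(j≰m , j-minimal) , x⋖j) =
      (j , x⋖j , m-irr , x≤m , j≰m) , minimal
      where
      x≤m : x ≤ m
      x≤m = lowerCover≤ j↓m x⋖j

      minimal : ∀ z → InS m z → z ≤ x → z ≡ x
      minimal z (y , z⋖y , _ , _ , y≰m) z≤x =
        trans (onlyLowerCover z z⋖j) (sym (onlyLowerCover x x⋖j))
        where
        x⋖x∨y : x ⋖ (x ∨ y)
        x⋖x∨y = liftCover z⋖y z≤x (λ y≤x → y≰m (≤-trans y≤x x≤m))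
        j≡x∨y : j ≡ (x ∨ y)
        j≡x∨y = exitCoverUnique m-irr x≤m x⋖j x⋖x∨y j≰m (≰-∨ x y≰m)
        z⋖j : z ⋖ j
        z⋖j = subst (z ⋖_) (j-minimal y y≰m (subst (y ≤_) (sym j≡x∨y) (y≤x∨y x y))) z⋖y

mainTheorem6 : (n : ℕ) (L : FinLattice n) →
    Notions.UpperLocallyDistributive L →
    ∀ m → Notions.IsMeetIrr L m →
    ∀ x → (Notions.InFrakU L m x ⇔
    (∃[ j ] (Notions.IsJoinIrr L j × Notions._↓_ L j m × Notions._⋖_ L x j)))
mainTheorem6 n L uld m m-irr x = mk⇔ frakU⇒lowerCover (lowerCover⇒frakU m-irr)
  where
  open FiniteLattice L
  open LocallyDistributive uld
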